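{- Let $\mathcal{H}$ be a finite family of tournaments. If $\mathcal{H}$ has the $(\mathcal{F},v,\eta)$-strong EH-property, then it has the $(\mathcal{F},v,\eta)$-super-strong EH-property.
   Context: Tournaments are finite; a subtournament is an induced subtournament; transitive means no directed cycle; $tr(T)$ is the maximum size of a transitive subtournament of $T$. $V_1$ is complete to $V_2$ if every vertex of $V_1$ has an edge to every vertex of $V_2$. For disjoint nonempty $X,Y\subseteq V(T)$, $d(X,Y)=e_{X,Y}/(|X||Y|)$ with $e_{X,Y}$ the number of edges $(x,y)$, $x\in X,y\in Y$. For a $\{0,1\}$-vector $v$ of length $m$, $\zeta^v(i)=|\{j\le i:v(j)=1\}|$; $\eta$ is a vector of positive integers of length $\zeta^v(m)$; $k=|\{j:v(j)=0\}|+\sum_i\eta(i)$. For a tournament $T$, $c>0$, $0\le\lambda<1$, a $(v,\eta,c,\lambda)$-m-sequence in $T$ is a sequence $\chi=(S_1,\dots,S_m)$ of pairwise disjoint subsets of $V(T)$ such that: if $v(i)=1$, $S_i$ induces a transitive subtournament and is partitioned into $S_{i,1},\dots,S_{i,\eta(\zeta^v(i))}$ with $S_{i,a}$ complete to $S_{i,b}$ for $a<b$ and each $|S_{i,a}|\ge c\,tr(T)$; if $v(i)=0$, $|S_i|\ge c|T|$; and $d(S_i,S_j)\ge1-\lambda$ for $i<j$. Its long representation $l(\chi)=(T_1,\dots,T_k)$ replaces each $S_i$ with $v(i)=1$ by $S_{i,1},\dots,S_{i,\eta(\zeta^v(i))}$ in order; $V(\chi)=\bigcup S_i$. A $c'$-strong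 pair in $\chi$ is a pair $(A,B)$ of disjoint subsets of $V(\chi)$ with $|A|\ge c'|T|$, either $|B|\ge c'|T|$ or ($B$ transitive and $|B|\ge c'\,tr(T)$), and $d(A,B)=1$ or $d(B,A)=1$. Let $\mathcal{H}=\{H_1,\dots,H_t\}$, $V(H_i)=\{h^i_1,\dots,h^i_{|H_i|}\}$, $\mathcal{F}=\{f_1,\dots,f_t\}$ with $f_i:V(H_i)\to\{1,\dots,k\}$ injective. $\mathcal{H}$ has the $(\mathcal{F},v,\eta)$-strong EH-property if for every $c_1>0$ there exist $\lambda_0>0,c_2>0$ such that for every tournament $T$, $0\le\lambda\le\lambda_0$ and $(v,\eta,c_1,\lambda)$-m-sequence $\chi$ in $T$ with $l(\chi)=(T_1,\dots,T_k)$, either there are $i$ and $x_j\in T_{f_i(h^i_j)}$ ($1\le j\le |H_i|$) such that $x_j\mapsto h^i_j$ is an isomorphism from the subtournament induced on $\{x_j\}$ onto $H_i$, or $\chi$ contains a $c_2$-strong pair. For a tournament $H$ with $V(H)=\{h_1,\dots,h_n\}$, $f:V(H)\to\{1,\dots,k\}$ and $\mu>0$, $H$ is $(f,\mu)$-well-embedded in $\chi$ (with $l(\chi)=(T_1,\dots,T_k)$) if there exist $x_1,\dots,x_n$ with $x_j\in T_{f(h_j)}$ such that $x_j\mapsto h_j$ is an isomorphism from the subtournament induced on $\{x_1,\dots,x_n\}$ onto $H$, and for every index $i$ such that no $x_j$ lies in $T_i$ and every $j$: $d(\{x_j\},T_i)\ge1-\mu$ if $f(h_j)<i$, and $d(T_i,\{x_j\})\ge1-\mu$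 if $f(h_j)>i$. $\mathcal{H}$ has the $(\mathcal{F},v,\eta)$-super-strong EH-property if for every $c_1>0$ there exist $\lambda_0>0,c_2>0$ such that for every tournament $T$, $0\le\lambda\le\lambda_0$ and $(v,\eta,c_1,\lambda)$-m-sequence $\chi$ in $T$, either some $H_i$ is $(f_i,\frac1{2k})$-well-embedded in $\chi$, or $\chi$ contains a $c_2$-strong pair.
   Formalization: The constants c₁, λ, λ₀ and c₂ in the strong and super-strong EH-properties range over the rationals. -}

module Defs where

open import Data.Bool using (Bool; true; false; not; _∧_; if_then_else_)
open import Data.Nat as ℕ using (ℕ; zero; suc; _+_; NonZero)
open import Data.Fin as Fin using (Fin; zero; suc; inject₁; fromℕ; splitAt)
open import Data.Fin.Subset using (Subset; _∈_; ∣_∣; ⁅_⁆)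
open import Data.Vec as Vec using (Vec; []; _∷_; lookup; tabulate)
open import Data.Integer using (+_)
open import Data.Rational using (ℚ; _/_; _≤_; _*_; 1ℚ; 0ℚ)
open import Data.Product using (Σ; _×_; _,_; ∃)
open import Data.Sum using (_⊎_)
open import Data.Empty using (⊥)
open import Relation.Nullary using (¬_)
open import Relation.Binary.PropositionalEquality using (_≡_; _≢_)

-- Tournaments: vertex set Fin n, adjacency adj x y = true iff x → y.

record Tournament : Set where
  field
    size   : ℕ
    adj    : Fin size → Fin size → Bool
    irrefl : ∀ x → adj x x ≡ false
    tourn  : ∀ x y → x ≢ y → adj x y ≡ not (adj y x)
open Tournament public

ℕtoℚ : ℕ → ℚ
ℕtoℚ a = + a / 1

module _ (T : Tournament) where
  private
    n = size T
    V = Fin n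

  Disjoint : Subset n → Subset n → Set
  Disjoint X Y = ∀ x → x ∈ X → x ∈ Y → ⊥

  DirectedCycleIn : Subset n → Set
  DirectedCycleIn S =
    Σ ℕ λ p → Σ (Fin (suc p) → V) λ w →
      (∀ i j → w i ≡ w j → i ≡ j) ×
      (∀ i → w i ∈ S) ×
      (∀ (i : Fin p) → adj T (w (inject₁ i)) (w (suc i)) ≡ true) ×
      (adj T (w (fromℕ p)) (w zero) ≡ true)

  TransitiveSet : Subset n → Set
  TransitiveSet S = ¬ DirectedCycleIn S

  IsTr : ℕ → Set
  IsTr t = (Σ (Subset n) λ S → TransitiveSet S × ∣ S ∣ ≡ t)
         × (∀ S → TransitiveSet S → ∣ S ∣ ℕ.≤ t)

  AtLeastTr : ℚ → Subset n → Set
  AtLeastTr c S = ∀ t → IsTr t → c * ℕtoℚ t ≤ ℕtoℚ ∣ S ∣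

  AtLeastT : ℚ → Subset n → Set
  AtLeastT c S = c * ℕtoℚ n ≤ ℕtoℚ ∣ S ∣

  CompleteTo : Subset n → Subset n → Set
  CompleteTo X Y = ∀ x y → x ∈ X → y ∈ Y → adj T x y ≡ true

  edges : Subset n → Subset n → ℕ
  edges X Y = Vec.sum (tabulate λ x → Vec.sum (tabulate λ y →
                if lookup X x ∧ lookup Y y ∧ adj T x y then 1 else 0))

  density : (X Y : Subset n) → NonZero (∣ X ∣ ℕ.* ∣ Y ∣) → ℚ
  density X Y nz = _/_ (+ edges X Y) (∣ X ∣ ℕ.* ∣ Y ∣) {{nz}}

  DensityAtLeast : Subset n → Subset n → ℚ → Set
  DensityAtLeast X Y r = Σ (NonZero (∣ X ∣ ℕ.* ∣ Y ∣)) λ nz → r ≤ density X Y nz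

  DensityOne : Subset n → Subset n → Set
  DensityOne X Y = Σ (NonZero (∣ X ∣ ℕ.* ∣ Y ∣)) λ nz → density X Y nz ≡ 1ℚ

ones : ∀ {m} → Vec Bool m → ℕ
ones [] = 0
ones (true ∷ v) = suc (ones v)
ones (false ∷ v) = ones v

-- ζ^v(i) (1-based position i, i.e. Fin index i counts positions 0..i)
ζ : ∀ {m} → Vec Bool m → Fin m → ℕ
ζ (b ∷ v) zero = if b then 1 else 0
ζ (b ∷ v) (suc i) = (if b then 1 else 0) + ζ v i

-- η(ζ^v(i)) for positions with v(i) = 1; irrelevant value 1 when v(i) = 0
ηAt : ∀ {m} (v : Vec Bool m) → Vec ℕ (ones v) → Fin m → ℕ
ηAt (true ∷ v) (e ∷ η) zero = e
ηAt (true ∷ v) (e ∷ η) (suc i) = ηAt v η i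
ηAt (false ∷ v) η zero = 1
ηAt (false ∷ v) η (suc i) = ηAt v η i

-- number of members of the long representation contributed by S_i
blocks : ∀ {m} (v : Vec Bool m) → Vec ℕ (ones v) → Vec ℕ m
blocks v η = tabulate λ i → if lookup v i then ηAt v η i else 1

-- k = |{j : v(j) = 0}| + Σ η(i)  (= Σ_i blocks i)
kOf : ∀ {m} (v : Vec Bool m) → Vec ℕ (ones v) → ℕ
kOf v η = Vec.sum (blocks v η)

-- decode a long index (0-based) into (i , a): the a-th piece of S_i
decode : ∀ {m} (bs : Vec ℕ m) → Fin (Vec.sum bs) → Σ (Fin m) λ i → Fin (lookup bs i)
decode (b ∷ bs) j with splitAt b j
... | Data.Sum.inj₁ a = zero , a
... | Data.Sum.inj₂ j' with decode bs j'
...   | i , a = suc i , a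

record MSeq (T : Tournament) {m : ℕ} (v : Vec Bool m) (η : Vec ℕ (ones v))
            (c λ' : ℚ) : Set where
  field
    S : Fin m → Subset (size T)
    -- pieces S_{i,1}, …, S_{i,η(ζ(i))} of S_i (for v(i) = 0 the single piece is S_i)
    P : (i : Fin m) → Fin (lookup (blocks v η) i) → Subset (size T)
    disjoint : ∀ i j → i ≢ j → Disjoint T (S i) (S j)
    one-transitive : ∀ i → lookup v i ≡ true → TransitiveSet T (S i)
    one-partition-disj : ∀ i → lookup v i ≡ true →
      ∀ a b → a ≢ b → Disjoint T (P i a) (P i b)
    one-partition-cover : ∀ i → lookup v i ≡ true →
      ∀ x → (x ∈ S i → ∃ λ a → x ∈ P i a) × (∀ a → x ∈ P i a → x ∈ S i)
    one-complete : ∀ i → lookup v i ≡ true →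
      ∀ a b → a Fin.< b → CompleteTo T (P i a) (P i b)
    one-size : ∀ i → lookup v i ≡ true → ∀ a → AtLeastTr T c (P i a)
    zero-piece : ∀ i → lookup v i ≡ false → ∀ a → P i a ≡ S i
    zero-size : ∀ i → lookup v i ≡ false → AtLeastT T c (S i)
    dense : ∀ i j → i Fin.< j → DensityAtLeast T (S i) (S j) (1ℚ Data.Rational.- λ')

module _ {T : Tournament} {m : ℕ} {v : Vec Bool m} {η : Vec ℕ (ones v)} {c λ' : ℚ}
         (χ : MSeq T v η c λ') where
  open MSeq χ

  -- long representation l(χ) = (T_1, …, T_k), indexed 0-based by Fin k
  long : Fin (kOf v η) → Subset (size T)
  long j with decode (blocks v η) j
  ... | i , a = P i a

  _∈Vχ : Fin (size T) → Set
  x ∈Vχ = ∃ λ i → x ∈ S i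

  HasStrongPair : ℚ → Set
  HasStrongPair c' = Σ (Subset (size T)) λ A → Σ (Subset (size T)) λ B →
    (∀ x → x ∈ A → x ∈Vχ) × (∀ x → x ∈ B → x ∈Vχ) × Disjoint T A B ×
    AtLeastT T c' A ×
    (AtLeastT T c' B ⊎ (TransitiveSet T B × AtLeastTr T c' B)) ×
    (DensityOne T A B ⊎ DensityOne T B A)

  Embedding : (H : Tournament) → (Fin (size H) → Fin (kOf v η)) →
              (Fin (size H) → Fin (size T)) → Set
  Embedding H f x =
    (∀ j → x j ∈ long (f j)) ×
    (∀ a b → x a ≡ x b → a ≡ b) ×
    (∀ a b → adj T (x a) (x b) ≡ adj H a b)

  Embeds : (H : Tournament) → (Fin (size H) → Fin (kOf v η)) → Set
  Embeds H f = Σ (Fin (size H) → Fin (size T)) λ x → Embedding H f x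

  WellEmbedded : (H : Tournament) → (Fin (size H) → Fin (kOf v η)) → ℚ → Set
  WellEmbedded H f μ = Σ (Fin (size H) → Fin (size T)) λ x →
    Embedding H f x ×
    (∀ i → (∀ j → ¬ (x j ∈ long i)) → ∀ j →
       (f j Fin.< i → DensityAtLeast T ⁅ x j ⁆ (long i) (1ℚ Data.Rational.- μ)) ×
       (i Fin.< f j → DensityAtLeast T (long i) ⁅ x j ⁆ (1ℚ Data.Rational.- μ)))

-- 1/(2k) (value for k = 0 is irrelevant: then there are no long indices)
inv2k : ℕ → ℚ
inv2k zero = 0ℚ
inv2k (suc k) = + 1 / (suc k + suc k)

-- EH properties. A family H_1..H_t is (Hs : Fin t → Tournament),
-- F = (f_1..f_t) is (Fs i : Fin (size (Hs i)) → Fin k).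

StrongEH : ∀ {t m} (Hs : Fin t → Tournament) (v : Vec Bool m) (η : Vec ℕ (ones v)) →
           ((i : Fin t) → Fin (size (Hs i)) → Fin (kOf v η)) → Set
StrongEH Hs v η Fs =
  ∀ (c₁ : ℚ) → 0ℚ Data.Rational.< c₁ →
  Σ ℚ λ λ₀ → Σ ℚ λ c₂ → 0ℚ Data.Rational.< λ₀ × 0ℚ Data.Rational.< c₂ ×
  (∀ (T : Tournament) (λ' : ℚ) → 0ℚ ≤ λ' → λ' ≤ λ₀ → λ' Data.Rational.< 1ℚ →
   (χ : MSeq T v η c₁ λ') →
   (Σ _ λ i → Embeds χ (Hs i) (Fs i)) ⊎ HasStrongPair χ c₂)

SuperStrongEH : ∀ {t m} (Hs : Fin t → Tournament) (v : Vec Bool m) (η : Vec ℕ (ones v)) →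
           ((i : Fin t) → Fin (size (Hs i)) → Fin (kOf v η)) → Set
SuperStrongEH Hs v η Fs =
  ∀ (c₁ : ℚ) → 0ℚ Data.Rational.< c₁ →
  Σ ℚ λ λ₀ → Σ ℚ λ c₂ → 0ℚ Data.Rational.< λ₀ × 0ℚ Data.Rational.< c₂ ×
  (∀ (T : Tournament) (λ' : ℚ) → 0ℚ ≤ λ' → λ' ≤ λ₀ → λ' Data.Rational.< 1ℚ →
   (χ : MSeq T v η c₁ λ') →
   (Σ _ λ i → WellEmbedded χ (Hs i) (Fs i) (inv2k (kOf v η))) ⊎ HasStrongPair χ c₂)

module Submission where

-- Given c₁, let M be the denominator of c₁, so that c₁·a ≤ b forces a ≤ M·b,
-- and apply the strong EH-property with c = 1/(2M); it yields λ₀' and c₂.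
-- Choose λ₀ = 1/N with N ≥ 4k²M² and N ≥ 4/λ₀'.  For a (v,η,c₁,λ)-m-sequence
-- χ with λ ≤ λ₀, call x ∈ S_I bad for the member T_i of l(χ) if x misses more
-- than |T_i|/(2k) of T_i in the direction in which S_I has to be complete to
-- T_i.  By density and Markov's inequality at most 2kM|S_I|/N vertices of S_I
-- are bad for each T_i, hence at most |S_I|/(2M) in total.  Deleting them
-- gives a (v,η,1/(2M),λ₀')-m-sequence χ' inside χ.  A strong pair of χ' is one
-- of χ, and a copy of some H_i in χ' consists of good vertices, which is
-- exactly what being (f_i, 1/(2k))-well-embedded in χ asks for.

open import Defs
open import Data.Bool as Bool using (Bool; true; false; not; _∧_; if_then_else_)
open import Data.Nat as ℕ using (ℕ; zero; suc; _+_; _*_; _≤_; _<_; z≤n; s≤s; NonZero)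
import Data.Nat.Properties as ℕP
open import Data.Nat.Solver using (module +-*-Solver)
open import Data.Integer as ℤ using (ℤ; +_; +[1+_])
import Data.Integer.Properties as ℤP
open import Data.Rational as ℚ using (ℚ; mkℚ; _/_; 1ℚ; 0ℚ; toℚᵘ; ↧ₙ_)
import Data.Rational.Properties as ℚP
open import Data.Rational.Unnormalised as ℚᵘ using (mkℚᵘ)
import Data.Rational.Unnormalised.Properties as ℚᵘP
open import Data.Fin as F using (Fin; zero; suc; toℕ; inject₁; fromℕ; splitAt)
import Data.Fin.Properties as FP
open import Data.Fin.Subset as Sub using (Subset; _∈_; ∣_∣; ⁅_⁆; outside)
import Data.Fin.Subset.Properties as SubP
open import Data.Vec as Vec using (Vec; []; _∷_; lookup; tabulate)
import Data.Vec.Properties as VP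
open import Algebra.Properties.Semiring.Sum ℕP.+-*-semiring
  using (sum; sum-syntax; sum-cong-≗; sum-replicate-zero; ∑-distrib-+; ∑-comm; *-distribˡ-sum; *-distribʳ-sum)
open import Data.Empty using (⊥; ⊥-elim)
open import Data.Sum as Sum using (_⊎_; inj₁; inj₂)
open import Data.Product using (Σ; ∃; _×_; _,_; proj₁; proj₂)
open import Relation.Nullary using (¬_; Dec; yes; no; does)
open import Relation.Nullary.Decidable using (_×-dec_; dec-true)
open import Relation.Binary using (Tri; tri<; tri≈; tri>)
open import Relation.Binary.PropositionalEquality

-- The fraction i/(d+1), seen as an unnormalised rational, is just mkℚᵘ i d:
-- every comparison of such fractions reduces to integer cross-multiplication.
toℚᵘ-/ : ∀ i d → toℚᵘ (i / suc d) ℚᵘ.≃ mkℚᵘ i d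
toℚᵘ-/ i d = ℚP.toℚᵘ-fromℚᵘ (mkℚᵘ i d)

+≤+⇒≤ : ∀ {x y} {i j : ℤ} → i ≡ + x → j ≡ + y → i ℤ.≤ j → x ≤ y
+≤+⇒≤ refl refl h = ℤP.drop‿+≤+ h

≤⇒+≤+ : ∀ {x y} {i j : ℤ} → i ≡ + x → j ≡ + y → x ≤ y → i ℤ.≤ j
≤⇒+≤+ refl refl h = ℤ.+≤+ h

-- A lower bound "c·a ≤ b" with c > 0 yields the integral bound a ≤ den(c)·b,
-- since c ≥ 1/den(c).
≤-denominator : ∀ (c : ℚ) → 0ℚ ℚ.< c → ∀ a b → c ℚ.* ℕtoℚ a ℚ.≤ ℕtoℚ b → a ≤ ↧ₙ c * b
≤-denominator c 0<c = go c (ℚ.positive 0<c)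
  where
  go : ∀ (c : ℚ) → ℚ.Positive c → ∀ a b → c ℚ.* ℕtoℚ a ℚ.≤ ℕtoℚ b → a ≤ ↧ₙ c * b
  go c@(mkℚ +[1+ p ] d _) _ a b h = begin
    a              ≤⟨ ℕP.m≤n*m a (suc p) ⟩
    suc p * a      ≤⟨ cross ⟩
    b * suc d      ≡⟨ ℕP.*-comm b (suc d) ⟩
    suc d * b      ∎
    where
    open ℕP.≤-Reasoning
    hᵘ : mkℚᵘ +[1+ p ] d ℚᵘ.* mkℚᵘ (+ a) 0 ℚᵘ.≤ mkℚᵘ (+ b) 0
    hᵘ = ℚᵘP.≤-respʳ-≃ (toℚᵘ-/ (+ b) 0)
           (ℚᵘP.≤-respˡ-≃ (ℚᵘP.≃-trans (ℚP.toℚᵘ-homo-* c (ℕtoℚ a))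
                                        (ℚᵘP.*-congˡ {mkℚᵘ +[1+ p ] d} (toℚᵘ-/ (+ a) 0)))
                          (ℚP.toℚᵘ-mono-≤ h))
    cross : suc p * a ≤ b * suc d
    cross = +≤+⇒≤ (trans (ℤP.*-identityʳ _) (sym (ℤP.pos-* (suc p) a)))
                  (trans (cong (λ z → + b ℤ.* + suc z) (ℕP.*-identityʳ d)) (sym (ℤP.pos-* b (suc d))))
                  (ℚᵘP.drop-*≤* hᵘ)

unit-fraction-≤ : ∀ K a b → a ≤ suc K * b → (+ 1 / suc K) ℚ.* ℕtoℚ a ℚ.≤ ℕtoℚ b
unit-fraction-≤ K a b h =
  ℚP.toℚᵘ-cancel-≤
    (ℚᵘP.≤-respʳ-≃ (ℚᵘP.≃-sym (toℚᵘ-/ (+ b) 0))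
      (ℚᵘP.≤-respˡ-≃ (ℚᵘP.≃-sym (ℚᵘP.≃-trans (ℚP.toℚᵘ-homo-* (+ 1 / suc K) (ℕtoℚ a))
                                             (ℚᵘP.*-cong (toℚᵘ-/ (+ 1) K) (toℚᵘ-/ (+ a) 0))))
                     hᵘ))
  where
  hᵘ : mkℚᵘ (+ 1) K ℚᵘ.* mkℚᵘ (+ a) 0 ℚᵘ.≤ mkℚᵘ (+ b) 0
  hᵘ = ℚᵘ.*≤* (≤⇒+≤+ (trans (ℤP.*-identityʳ _) (ℤP.*-identityˡ (+ a)))
                      (trans (cong (λ z → + b ℤ.* + suc z) (ℕP.*-identityʳ K)) (sym (ℤP.pos-* b (suc K))))
                      (ℕP.≤-trans h (ℕP.≤-reflexive (ℕP.*-comm (suc K) b))))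

-≤⇒≤+ : ∀ p q r → p ℚ.- q ℚ.≤ r → p ℚ.≤ r ℚ.+ q
-≤⇒≤+ p q r h = subst (ℚ._≤ r ℚ.+ q) eq (ℚP.+-monoˡ-≤ q h)
  where
  eq : (p ℚ.- q) ℚ.+ q ≡ p
  eq = trans (ℚP.+-assoc p (ℚ.- q) q) (trans (cong (p ℚ.+_) (ℚP.+-inverseˡ q)) (ℚP.+-identityʳ p))

≤+⇒-≤ : ∀ p q r → p ℚ.≤ r ℚ.+ q → p ℚ.- q ℚ.≤ r
≤+⇒-≤ p q r h = subst (p ℚ.- q ℚ.≤_) eq (ℚP.+-monoˡ-≤ (ℚ.- q) h)
  where
  eq : (r ℚ.+ q) ℚ.- q ≡ r
  eq = trans (ℚP.+-assoc r q (ℚ.- q)) (trans (cong (r ℚ.+_) (ℚP.+-inverseʳ q)) (ℚP.+-identityʳ r))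

-- The core equivalence behind densities: if e + m = P (edges plus misses is
-- the number of pairs), then 1 ≤ e/P + 1/(N+1)  ⇔  (N+1)·m ≤ P.
private
  sum-of-fractions : ∀ e P' N' → toℚᵘ ((+ e / suc P') ℚ.+ (+ 1 / suc N')) ℚᵘ.≃ mkℚᵘ (+ e) P' ℚᵘ.+ mkℚᵘ (+ 1) N'
  sum-of-fractions e P' N' =
    ℚᵘP.≃-trans (ℚP.toℚᵘ-homo-+ (+ e / suc P') (+ 1 / suc N')) (ℚᵘP.+-cong (toℚᵘ-/ (+ e) P') (toℚᵘ-/ (+ 1) N'))

  numerator-of-sum : ∀ e N P → + e ℤ.* + N ℤ.+ + 1 ℤ.* + P ≡ + (e * N + P)
  numerator-of-sum e N P =
    trans (cong₂ ℤ._+_ (sym (ℤP.pos-* e N)) (ℤP.*-identityˡ (+ P))) (sym (ℤP.pos-+ (e * N) P))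

  -- (N+1)·m ≤ P  ⇔  P·(N+1) ≤ e·(N+1) + P, after adding e·(N+1) to both sides
  scaled : ∀ e m N' P' → e + m ≡ suc P' → e * suc N' + suc N' * m ≡ suc P' * suc N'
  scaled e m N' P' eq = begin
    e * suc N' + suc N' * m   ≡⟨ cong (_+ suc N' * m) (ℕP.*-comm e (suc N')) ⟩
    suc N' * e + suc N' * m   ≡⟨ ℕP.*-distribˡ-+ (suc N') e m ⟨
    suc N' * (e + m)          ≡⟨ cong (suc N' *_) eq ⟩
    suc N' * suc P'           ≡⟨ ℕP.*-comm (suc N') (suc P') ⟩
    suc P' * suc N'           ∎
    where open ≡-Reasoning

  one≤⇒misses : ∀ e m N' P' → e + m ≡ suc P' →
                1ℚ ℚ.≤ (+ e / suc P') ℚ.+ (+ 1 / suc N') → suc N' * m ≤ suc P'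
  one≤⇒misses e m N' P' eq h =
    ℕP.+-cancelˡ-≤ (e * suc N') _ _ (subst (_≤ e * suc N' + suc P') (sym (scaled e m N' P' eq)) cross)
    where
    hᵘ : mkℚᵘ (+ 1) 0 ℚᵘ.≤ mkℚᵘ (+ e) P' ℚᵘ.+ mkℚᵘ (+ 1) N'
    hᵘ = ℚᵘP.≤-respʳ-≃ (sum-of-fractions e P' N') (ℚᵘP.≤-respˡ-≃ (toℚᵘ-/ (+ 1) 0) (ℚP.toℚᵘ-mono-≤ h))
    cross : suc P' * suc N' ≤ e * suc N' + suc P'
    cross = +≤+⇒≤ (ℤP.*-identityˡ _) (trans (ℤP.*-identityʳ _) (numerator-of-sum e (suc N') (suc P')))
                  (ℚᵘP.drop-*≤* hᵘ)

  misses⇒one≤ : ∀ e m N' P' → e + m ≡ suc P' →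
                suc N' * m ≤ suc P' → 1ℚ ℚ.≤ (+ e / suc P') ℚ.+ (+ 1 / suc N')
  misses⇒one≤ e m N' P' eq h =
    ℚP.toℚᵘ-cancel-≤ (ℚᵘP.≤-respʳ-≃ (ℚᵘP.≃-sym (sum-of-fractions e P' N'))
                       (ℚᵘP.≤-respˡ-≃ (ℚᵘP.≃-sym (toℚᵘ-/ (+ 1) 0)) hᵘ))
    where
    cross : suc P' * suc N' ≤ e * suc N' + suc P'
    cross = subst (_≤ e * suc N' + suc P') (scaled e m N' P' eq) (ℕP.+-monoʳ-≤ (e * suc N') h)
    hᵘ : mkℚᵘ (+ 1) 0 ℚᵘ.≤ mkℚᵘ (+ e) P' ℚᵘ.+ mkℚᵘ (+ 1) N'
    hᵘ = ℚᵘ.*≤* (≤⇒+≤+ (ℤP.*-identityˡ _) (trans (ℤP.*-identityʳ _) (numerator-of-sum e (suc N') (suc P'))) cross)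

density⇒misses : ∀ e m N' λ' P .{{_ : NonZero P}} → e + m ≡ P →
                 λ' ℚ.≤ (+ 1 / suc N') → 1ℚ ℚ.- λ' ℚ.≤ (+ e / P) → suc N' * m ≤ P
density⇒misses e m N' λ' (suc P') eq λ≤ h =
  one≤⇒misses e m N' P' eq (ℚP.≤-trans (-≤⇒≤+ 1ℚ λ' _ h) (ℚP.+-monoʳ-≤ (+ e / suc P') λ≤))

misses⇒density : ∀ e m N' P .{{_ : NonZero P}} → e + m ≡ P →
                 suc N' * m ≤ P → 1ℚ ℚ.- (+ 1 / suc N') ℚ.≤ (+ e / P)
misses⇒density e m N' (suc P') eq h = ≤+⇒-≤ 1ℚ _ _ (misses⇒one≤ e m N' P' eq h)

unit-fraction-pos : ∀ K → 0ℚ ℚ.< (+ 1 / suc K)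
unit-fraction-pos K =
  ℚP.toℚᵘ-cancel-< (ℚᵘP.<-respʳ-≃ (ℚᵘP.≃-sym (toℚᵘ-/ (+ 1) K))
                     (ℚᵘP.<-respˡ-≃ (ℚᵘP.≃-sym (toℚᵘ-/ (+ 0) 0)) (ℚᵘ.*<* (ℤ.+<+ (s≤s z≤n)))))

unit-fraction-<1 : ∀ K → (+ 1 / suc (suc K)) ℚ.< 1ℚ
unit-fraction-<1 K =
  ℚP.toℚᵘ-cancel-< (ℚᵘP.<-respʳ-≃ (ℚᵘP.≃-sym (toℚᵘ-/ (+ 1) 0))
                     (ℚᵘP.<-respˡ-≃ (ℚᵘP.≃-sym (toℚᵘ-/ (+ 1) (suc K))) (ℚᵘ.*<* (ℤ.+<+ (s≤s (s≤s z≤n))))))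

unit-fraction-below : ∀ x → 0ℚ ℚ.< x → Σ ℕ λ K → (+ 1 / suc (suc K)) ℚ.≤ x
unit-fraction-below x 0<x = go x (ℚ.positive 0<x)
  where
  go : ∀ x → ℚ.Positive x → Σ ℕ λ K → (+ 1 / suc (suc K)) ℚ.≤ x
  go (mkℚ +[1+ p ] d _) _ =
    d , ℚP.toℚᵘ-cancel-≤ (ℚᵘP.≤-respˡ-≃ (ℚᵘP.≃-sym (toℚᵘ-/ (+ 1) (suc d)))
                           (ℚᵘ.*≤* (≤⇒+≤+ (ℤP.*-identityˡ _) (sym (ℤP.pos-* (suc p) (suc (suc d)))) cross)))
    where
    cross : suc d ≤ suc p * suc (suc d)
    cross = ℕP.≤-trans (ℕP.n≤1+n (suc d)) (ℕP.m≤n*m (suc (suc d)) (suc p))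

-- A set is transitive iff it contains no directed triangle; since triangles
-- can be searched for, transitivity is decidable, and hence tr(T) exists.
module _ (T : Tournament) where
  private
    V = Fin (size T)

  Triangle : Subset (size T) → Set
  Triangle S = Σ V λ a → Σ V λ b → Σ V λ c → (a ∈ S × b ∈ S × c ∈ S) ×
               (adj T a b ≡ true × adj T b c ≡ true × adj T c a ≡ true)

  edge⇒≢ : ∀ {a b} → adj T a b ≡ true → a ≢ b
  edge⇒≢ {a} e refl with trans (sym e) (irrefl T a)
  ... | ()

  reverse-edge : ∀ {a b} → a ≢ b → adj T a b ≡ false → adj T b a ≡ true
  reverse-edge {a} {b} a≢b e = trans (tourn T b a (λ q → a≢b (sym q))) (cong not e)

  switch : ∀ p (g : Fin (suc p) → Bool) → g zero ≡ true → g (fromℕ p) ≡ false →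
           Σ (Fin p) λ i → g (inject₁ i) ≡ true × g (suc i) ≡ false
  switch zero g t f with trans (sym t) f
  ... | ()
  switch (suc p) g t f with g (suc zero) in eq
  ... | false = zero , t , eq
  ... | true with switch p (λ j → g (suc j)) eq f
  ...   | i , a , b = suc i , a , b

  -- In a directed cycle w₀ → w₁ → ⋯ → w_p → w₀, the edges from w₀ start out
  -- forward and end backward; where they switch, w₀ lies on a triangle.
  cycle⇒triangle : ∀ S → DirectedCycleIn T S → Triangle S
  cycle⇒triangle S (zero , w , _ , _ , _ , loop) with trans (sym loop) (irrefl T (w zero))
  ... | ()
  cycle⇒triangle S (suc p , w , inj , mem , path , close)
    with switch p (λ j → adj T (w zero) (w (suc j))) (path zero) last-backward
    where
    last-backward : adj T (w zero) (w (suc (fromℕ p))) ≡ false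
    last-backward = trans (tourn T _ _ (λ q → 0≢ (inj _ _ q))) (cong not close)
      where
      0≢ : zero ≢ suc (fromℕ p)
      0≢ ()
  ... | i , forward , backward =
    w zero , w (suc (inject₁ i)) , w (suc (suc i)) , (mem _ , mem _ , mem _) ,
    (forward , path (suc i) , reverse-edge (λ q → 0≢ (inj _ _ q)) backward)
    where
    0≢ : zero ≢ suc (suc i)
    0≢ ()

  triangle⇒cycle : ∀ S → Triangle S → DirectedCycleIn T S
  triangle⇒cycle S (a , b , c , (a∈ , b∈ , c∈) , (ab , bc , ca)) = 2 , w , inj , mem , path , ca
    where
    w : Fin 3 → V
    w zero = a
    w (suc zero) = b
    w (suc (suc zero)) = c
    inj : ∀ i j → w i ≡ w j → i ≡ j
    inj zero zero q = refl
    inj zero (suc zero) q = ⊥-elim (edge⇒≢ ab q)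
    inj zero (suc (suc zero)) q = ⊥-elim (edge⇒≢ ca (sym q))
    inj (suc zero) zero q = ⊥-elim (edge⇒≢ ab (sym q))
    inj (suc zero) (suc zero) q = refl
    inj (suc zero) (suc (suc zero)) q = ⊥-elim (edge⇒≢ bc q)
    inj (suc (suc zero)) zero q = ⊥-elim (edge⇒≢ ca q)
    inj (suc (suc zero)) (suc zero) q = ⊥-elim (edge⇒≢ bc (sym q))
    inj (suc (suc zero)) (suc (suc zero)) q = refl
    mem : ∀ i → w i ∈ S
    mem zero = a∈
    mem (suc zero) = b∈
    mem (suc (suc zero)) = c∈
    path : ∀ (i : Fin 2) → adj T (w (inject₁ i)) (w (suc i)) ≡ true
    path zero = ab
    path (suc zero) = bc

  triangle? : ∀ S → Dec (Triangle S)
  triangle? S = FP.any? λ a → FP.any? λ b → FP.any? λ c →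
    ((a SubP.∈? S) ×-dec ((b SubP.∈? S) ×-dec (c SubP.∈? S))) ×-dec
    ((adj T a b Bool.≟ true) ×-dec ((adj T b c Bool.≟ true) ×-dec (adj T c a Bool.≟ true)))

  transitive? : ∀ S → Dec (TransitiveSet T S)
  transitive? S with triangle? S
  ... | yes t = no λ acyclic → acyclic (triangle⇒cycle S t)
  ... | no ¬t = yes λ c → ¬t (cycle⇒triangle S c)

  transitive-⊆ : ∀ {A B} → (∀ x → x ∈ A → x ∈ B) → TransitiveSet T B → TransitiveSet T A
  transitive-⊆ A⊆B tB (p , w , inj , mem , path , close) = tB (p , w , inj , (λ i → A⊆B _ (mem i)) , path , close)

  singleton-transitive : ∀ x → TransitiveSet T ⁅ x ⁆
  singleton-transitive x c with cycle⇒triangle ⁅ x ⁆ c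
  ... | a , b , _ , (a∈ , b∈ , _) , (ab , _)
    with SubP.x∈⁅y⁆⇒x≡y x a∈ | SubP.x∈⁅y⁆⇒x≡y x b∈
  ... | refl | refl = edge⇒≢ ab refl

  private
    HasTransitive : ℕ → Set
    HasTransitive t = Σ (Subset (size T)) λ S → TransitiveSet T S × t ≤ ∣ S ∣

    has-transitive? : ∀ t → Dec (HasTransitive t)
    has-transitive? t = SubP.anySubset? (λ S → transitive? S ×-dec (t ℕ.≤? ∣ S ∣))

    -- scan t, t+1, … (at most |T| steps) for the last size that is attained
    largest : ∀ fuel t → size T < t + fuel → HasTransitive t →
              Σ ℕ λ t' → HasTransitive t' × ¬ HasTransitive (suc t')
    largest zero t lt (S , _ , t≤) =
      ⊥-elim (ℕP.<⇒≱ (subst (size T <_) (ℕP.+-identityʳ t) lt) (ℕP.≤-trans t≤ (SubP.∣p∣≤n S)))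
    largest (suc fuel) t lt h with has-transitive? (suc t)
    ... | no ¬h = t , h , ¬h
    ... | yes h' = largest fuel (suc t) (subst (size T <_) (ℕP.+-suc t fuel) lt) h'

  tr-exists : Σ ℕ (IsTr T)
  tr-exists with largest (suc (size T)) 0 (ℕP.n<1+n _) (Sub.⊥ , ∅-transitive , z≤n)
    where
    ∅-transitive : TransitiveSet T Sub.⊥
    ∅-transitive c with cycle⇒triangle Sub.⊥ c
    ... | _ , _ , _ , (a∈ , _) , _ = SubP.∉⊥ a∈
  ... | t , (S , tS , t≤) , ¬bigger =
    t , (S , tS , ℕP.≤-antisym (ℕP.≮⇒≥ λ lt → ¬bigger (S , tS , lt)) t≤) ,
    (λ S' tS' → ℕP.≮⇒≥ λ lt → ¬bigger (S' , tS' , lt))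

-- Counting with indicator functions: all cardinalities and edge counts are
-- written as sums ∑[ x < n ] ⟦ b x ⟧ over the vertex set.
⟦_⟧ : Bool → ℕ
⟦ b ⟧ = if b then 1 else 0

Vec-sum-tabulate : ∀ {n} (f : Fin n → ℕ) → Vec.sum (tabulate f) ≡ sum f
Vec-sum-tabulate {zero} f = refl
Vec-sum-tabulate {suc n} f = cong (_+_ (f zero)) (Vec-sum-tabulate (λ x → f (suc x)))

sum-mono : ∀ {n} {f g : Fin n → ℕ} → (∀ x → f x ≤ g x) → sum f ≤ sum g
sum-mono {zero} f≤g = z≤n
sum-mono {suc n} f≤g = ℕP.+-mono-≤ (f≤g zero) (sum-mono (λ x → f≤g (suc x)))

sum-zero : ∀ {n} {f : Fin n → ℕ} → (∀ x → f x ≡ 0) → sum f ≡ 0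
sum-zero {n} f≡0 = trans (sum-cong-≗ f≡0) (sum-replicate-zero n)

sum-const : ∀ n a → ∑[ _ < n ] a ≡ n * a
sum-const zero a = refl
sum-const (suc n) a = cong (_+_ a) (sum-const n a)

term≤sum : ∀ {n} (f : Fin n → ℕ) i → f i ≤ sum f
term≤sum f zero = ℕP.m≤m+n _ _
term≤sum f (suc i) = ℕP.≤-trans (term≤sum (λ x → f (suc x)) i) (ℕP.m≤n+m _ (f zero))

∈⇒true : ∀ {n} {x : Fin n} {X : Subset n} → x ∈ X → lookup X x ≡ true
∈⇒true = VP.[]=⇒lookup

true⇒∈ : ∀ {n} {x : Fin n} {X : Subset n} → lookup X x ≡ true → x ∈ X
true⇒∈ {x = x} {X} = VP.lookup⇒[]= x X

∣∣≡∑ : ∀ {n} (X : Subset n) → ∣ X ∣ ≡ ∑[ x < n ] ⟦ lookup X x ⟧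
∣∣≡∑ [] = refl
∣∣≡∑ (true ∷ X) = cong suc (∣∣≡∑ X)
∣∣≡∑ (false ∷ X) = ∣∣≡∑ X

∑-⊥ : ∀ {n} (g : Fin n → ℕ) → ∑[ z < n ] (⟦ lookup (Sub.⊥ {n}) z ⟧ * g z) ≡ 0
∑-⊥ g = sum-zero (λ z → cong (λ b → ⟦ b ⟧ * g z) (VP.lookup-replicate z outside))

∑-⁅⁆ : ∀ {n} (x : Fin n) (g : Fin n → ℕ) → ∑[ z < n ] (⟦ lookup ⁅ x ⁆ z ⟧ * g z) ≡ g x
∑-⁅⁆ {suc n} zero g = trans (cong₂ _+_ (ℕP.+-identityʳ (g zero)) (∑-⊥ (λ z → g (suc z)))) (ℕP.+-identityʳ _)
∑-⁅⁆ {suc n} (suc x) g = ∑-⁅⁆ x (λ z → g (suc z))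

∧-true : ∀ {a b} → (a ∧ b) ≡ true → a ≡ true × b ≡ true
∧-true {true} h = refl , h

⟦⟧-mono : ∀ {a b} → (a ≡ true → b ≡ true) → ⟦ a ⟧ ≤ ⟦ b ⟧
⟦⟧-mono {false} a⇒b = z≤n
⟦⟧-mono {true} a⇒b rewrite a⇒b refl = ℕP.≤-refl

⟦⟧-false : ∀ {b} → (b ≡ true → ⊥) → ⟦ b ⟧ ≡ 0
⟦⟧-false {false} _ = refl
⟦⟧-false {true} h = ⊥-elim (h refl)

markov : ∀ {n} (S : Subset n) (b : Fin n → Bool) (r : Fin n → ℕ) (L K : ℕ) →
         (∀ x → lookup S x ≡ true → b x ≡ true → L < K * r x) →
         (∑[ x < n ] ⟦ lookup S x ∧ b x ⟧) * L ≤ K * ∑[ x < n ] (⟦ lookup S x ⟧ * r x)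
markov {n} S b r L K big = begin
  (∑[ x < n ] ⟦ lookup S x ∧ b x ⟧) * L   ≡⟨ *-distribʳ-sum L (λ x → ⟦ lookup S x ∧ b x ⟧) ⟩
  ∑[ x < n ] (⟦ lookup S x ∧ b x ⟧ * L)   ≤⟨ sum-mono termwise ⟩
  ∑[ x < n ] (K * (⟦ lookup S x ⟧ * r x)) ≡⟨ *-distribˡ-sum K (λ x → ⟦ lookup S x ⟧ * r x) ⟨
  K * ∑[ x < n ] (⟦ lookup S x ⟧ * r x)   ∎
  where
  open ℕP.≤-Reasoning
  termwise : ∀ x → ⟦ lookup S x ∧ b x ⟧ * L ≤ K * (⟦ lookup S x ⟧ * r x)
  termwise x with lookup S x in x∈S | b x in bx
  ... | false | _ = z≤n
  ... | true | false = z≤n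
  ... | true | true rewrite ℕP.+-identityʳ L | ℕP.+-identityʳ (r x) = ℕP.<⇒≤ (big x x∈S bx)

module Misses (T : Tournament) where
  private
    n = size T

  missesTo : Subset n → Fin n → ℕ
  missesTo Y x = ∑[ y < n ] ⟦ lookup Y y ∧ not (adj T x y) ⟧

  missesFrom : Subset n → Fin n → ℕ
  missesFrom X y = ∑[ x < n ] ⟦ lookup X x ∧ not (adj T x y) ⟧

  misses : Subset n → Subset n → ℕ
  misses X Y = ∑[ x < n ] (⟦ lookup X x ⟧ * missesTo Y x)

  edges≡∑∑ : ∀ X Y → edges T X Y ≡ ∑[ x < n ] ∑[ y < n ] ⟦ lookup X x ∧ lookup Y y ∧ adj T x y ⟧
  edges≡∑∑ X Y =
    trans (Vec-sum-tabulate (λ x → Vec.sum (tabulate λ y → ⟦ lookup X x ∧ lookup Y y ∧ adj T x y ⟧)))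
          (sum-cong-≗ (λ x → Vec-sum-tabulate (λ y → ⟦ lookup X x ∧ lookup Y y ∧ adj T x y ⟧)))

  -- every pair is either an edge or a miss
  edges+misses : ∀ X Y → edges T X Y + misses X Y ≡ ∣ X ∣ * ∣ Y ∣
  edges+misses X Y = begin
    edges T X Y + misses X Y
      ≡⟨ cong (_+ misses X Y) (edges≡∑∑ X Y) ⟩
    ∑[ x < n ] ∑[ y < n ] ⟦ lookup X x ∧ lookup Y y ∧ adj T x y ⟧ + misses X Y
      ≡⟨ ∑-distrib-+ (λ x → ∑[ y < n ] ⟦ lookup X x ∧ lookup Y y ∧ adj T x y ⟧) (λ x → ⟦ lookup X x ⟧ * missesTo Y x) ⟨
    ∑[ x < n ] (∑[ y < n ] ⟦ lookup X x ∧ lookup Y y ∧ adj T x y ⟧ + ⟦ lookup X x ⟧ * missesTo Y x)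
      ≡⟨ sum-cong-≗ row ⟩
    ∑[ x < n ] (⟦ lookup X x ⟧ * ∣ Y ∣)
      ≡⟨ *-distribʳ-sum ∣ Y ∣ (λ x → ⟦ lookup X x ⟧) ⟨
    (∑[ x < n ] ⟦ lookup X x ⟧) * ∣ Y ∣
      ≡⟨ cong (_* ∣ Y ∣) (∣∣≡∑ X) ⟨
    ∣ X ∣ * ∣ Y ∣ ∎
    where
    open ≡-Reasoning
    split : ∀ a c → ⟦ a ∧ c ⟧ + ⟦ a ∧ not c ⟧ ≡ ⟦ a ⟧
    split true true = refl
    split true false = refl
    split false c = refl
    row : ∀ x → ∑[ y < n ] ⟦ lookup X x ∧ lookup Y y ∧ adj T x y ⟧ + ⟦ lookup X x ⟧ * missesTo Y x
                ≡ ⟦ lookup X x ⟧ * ∣ Y ∣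
    row x with lookup X x
    ... | false = trans (ℕP.+-identityʳ _) (sum-zero {n} {λ y → ⟦ false ∧ lookup Y y ∧ adj T x y ⟧} (λ y → refl))
    ... | true = begin
      ∑[ y < n ] ⟦ lookup Y y ∧ adj T x y ⟧ + (missesTo Y x + 0)
        ≡⟨ cong (_+_ (∑[ y < n ] ⟦ lookup Y y ∧ adj T x y ⟧)) (ℕP.+-identityʳ _) ⟩
      ∑[ y < n ] ⟦ lookup Y y ∧ adj T x y ⟧ + missesTo Y x
        ≡⟨ ∑-distrib-+ (λ y → ⟦ lookup Y y ∧ adj T x y ⟧) (λ y → ⟦ lookup Y y ∧ not (adj T x y) ⟧) ⟨
      ∑[ y < n ] (⟦ lookup Y y ∧ adj T x y ⟧ + ⟦ lookup Y y ∧ not (adj T x y) ⟧)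
        ≡⟨ sum-cong-≗ (λ y → split (lookup Y y) (adj T x y)) ⟩
      ∑[ y < n ] ⟦ lookup Y y ⟧
        ≡⟨ trans (ℕP.+-identityʳ _) (∣∣≡∑ Y) ⟨
      ∣ Y ∣ + 0 ∎

  misses-by-column : ∀ X Y → misses X Y ≡ ∑[ y < n ] (⟦ lookup Y y ⟧ * missesFrom X y)
  misses-by-column X Y = begin
    ∑[ x < n ] (⟦ lookup X x ⟧ * missesTo Y x)
      ≡⟨ sum-cong-≗ (λ x → *-distribˡ-sum ⟦ lookup X x ⟧ (λ y → ⟦ lookup Y y ∧ not (adj T x y) ⟧)) ⟩
    ∑[ x < n ] ∑[ y < n ] (⟦ lookup X x ⟧ * ⟦ lookup Y y ∧ not (adj T x y) ⟧)
      ≡⟨ ∑-comm (λ x y → ⟦ lookup X x ⟧ * ⟦ lookup Y y ∧ not (adj T x y) ⟧) ⟩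
    ∑[ y < n ] ∑[ x < n ] (⟦ lookup X x ⟧ * ⟦ lookup Y y ∧ not (adj T x y) ⟧)
      ≡⟨ sum-cong-≗ (λ y → sum-cong-≗ (λ x → swap (lookup X x) (lookup Y y) (adj T x y))) ⟩
    ∑[ y < n ] ∑[ x < n ] (⟦ lookup Y y ⟧ * ⟦ lookup X x ∧ not (adj T x y) ⟧)
      ≡⟨ sum-cong-≗ (λ y → *-distribˡ-sum ⟦ lookup Y y ⟧ (λ x → ⟦ lookup X x ∧ not (adj T x y) ⟧)) ⟨
    ∑[ y < n ] (⟦ lookup Y y ⟧ * missesFrom X y) ∎
    where
    open ≡-Reasoning
    swap : ∀ a b c → ⟦ a ⟧ * ⟦ b ∧ not c ⟧ ≡ ⟦ b ⟧ * ⟦ a ∧ not c ⟧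
    swap true true c = refl
    swap true false c = refl
    swap false true c = sym (ℕP.+-identityʳ _)
    swap false false c = refl

  misses-mono : ∀ {X X' Y Y'} → (∀ x → lookup X' x ≡ true → lookup X x ≡ true) →
                (∀ y → lookup Y' y ≡ true → lookup Y y ≡ true) → misses X' Y' ≤ misses X Y
  misses-mono X'⊆X Y'⊆Y = sum-mono λ x →
    ℕP.*-mono-≤ (⟦⟧-mono (X'⊆X x))
                (sum-mono λ y → ⟦⟧-mono λ q → let (y∈ , nxy) = ∧-true q in
                                               cong₂ _∧_ (Y'⊆Y y y∈) nxy)

  misses-⁅⁆ˡ : ∀ x Y → misses ⁅ x ⁆ Y ≡ missesTo Y x
  misses-⁅⁆ˡ x Y = ∑-⁅⁆ x (missesTo Y)

  misses-⁅⁆ʳ : ∀ y X → misses X ⁅ y ⁆ ≡ missesFrom X y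
  misses-⁅⁆ʳ y X = trans (misses-by-column X ⁅ y ⁆) (∑-⁅⁆ y (missesFrom X))

  private
    contradictory : ∀ {b} → b ≡ true → not b ≡ true → ⊥
    contradictory refl ()

  missesTo-complete : ∀ Y x → (∀ y → lookup Y y ≡ true → adj T x y ≡ true) → missesTo Y x ≡ 0
  missesTo-complete Y x complete = sum-zero λ y → ⟦⟧-false λ q →
    let (y∈ , nxy) = ∧-true q in contradictory (complete y y∈) nxy

  missesFrom-complete : ∀ X y → (∀ x → lookup X x ≡ true → adj T x y ≡ true) → missesFrom X y ≡ 0
  missesFrom-complete X y complete = sum-zero λ x → ⟦⟧-false λ q →
    let (x∈ , nxy) = ∧-true q in contradictory (complete x x∈) nxy

  missesTo≤ : ∀ Y x → missesTo Y x ≤ ∣ Y ∣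
  missesTo≤ Y x = ℕP.≤-trans (sum-mono {g = λ y → ⟦ lookup Y y ⟧} λ y → ⟦⟧-mono (λ q → proj₁ (∧-true q)))
                             (ℕP.≤-reflexive (sym (∣∣≡∑ Y)))

  missesFrom≤ : ∀ X y → missesFrom X y ≤ ∣ X ∣
  missesFrom≤ X y = ℕP.≤-trans (sum-mono {g = λ x → ⟦ lookup X x ⟧} λ x → ⟦⟧-mono (λ q → proj₁ (∧-true q)))
                               (ℕP.≤-reflexive (sym (∣∣≡∑ X)))

module DensityByMisses (T : Tournament) where
  open Misses T

  misses⇒dense : ∀ X Y N' → 0 < ∣ X ∣ * ∣ Y ∣ → suc N' * misses X Y ≤ ∣ X ∣ * ∣ Y ∣ →
                 DensityAtLeast T X Y (1ℚ ℚ.- (+ 1 / suc N'))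
  misses⇒dense X Y N' pos few = nz , misses⇒density (edges T X Y) (misses X Y) N' _ {{nz}} (edges+misses X Y) few
    where
    nz : NonZero (∣ X ∣ * ∣ Y ∣)
    nz = ℕ.>-nonZero pos

  dense⇒misses : ∀ X Y N' λ' → λ' ℚ.≤ (+ 1 / suc N') → DensityAtLeast T X Y (1ℚ ℚ.- λ') →
                 suc N' * misses X Y ≤ ∣ X ∣ * ∣ Y ∣
  dense⇒misses X Y N' λ' λ≤ (nz , dense) =
    density⇒misses (edges T X Y) (misses X Y) N' λ' _ {{nz}} (edges+misses X Y) λ≤ dense

  missesTo⇒dense : ∀ x Y N' → 0 < ∣ Y ∣ → suc N' * missesTo Y x ≤ ∣ Y ∣ →
                   DensityAtLeast T ⁅ x ⁆ Y (1ℚ ℚ.- (+ 1 / suc N'))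
  missesTo⇒dense x Y N' pos few =
    misses⇒dense ⁅ x ⁆ Y N' (subst (0 <_) (sym pairs) pos)
      (subst₂ _≤_ (cong (suc N' *_) (sym (misses-⁅⁆ˡ x Y))) (sym pairs) few)
    where
    pairs : ∣ ⁅ x ⁆ ∣ * ∣ Y ∣ ≡ ∣ Y ∣
    pairs = trans (cong (_* ∣ Y ∣) (SubP.∣⁅x⁆∣≡1 x)) (ℕP.*-identityˡ _)

  missesFrom⇒dense : ∀ y X N' → 0 < ∣ X ∣ → suc N' * missesFrom X y ≤ ∣ X ∣ →
                     DensityAtLeast T X ⁅ y ⁆ (1ℚ ℚ.- (+ 1 / suc N'))
  missesFrom⇒dense y X N' pos few =
    misses⇒dense X ⁅ y ⁆ N' (subst (0 <_) (sym pairs) pos)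
      (subst₂ _≤_ (cong (suc N' *_) (sym (misses-⁅⁆ʳ y X))) (sym pairs) few)
    where
    pairs : ∣ X ∣ * ∣ ⁅ y ⁆ ∣ ≡ ∣ X ∣
    pairs = trans (cong (∣ X ∣ *_) (SubP.∣⁅x⁆∣≡1 y)) (ℕP.*-identityʳ _)

LexBefore : ∀ {m} (bs : Vec ℕ m) → Fin (Vec.sum bs) → Fin (Vec.sum bs) → Set
LexBefore bs i j =
  (toℕ (proj₁ (decode bs i)) < toℕ (proj₁ (decode bs j))) ⊎
  (Σ (proj₁ (decode bs i) ≡ proj₁ (decode bs j)) λ _ →
     toℕ (proj₂ (decode bs i)) < toℕ (proj₂ (decode bs j)))

private
  toℕ-splitˡ : ∀ b {n} {i : Fin (b + n)} {a} → splitAt b i ≡ inj₁ a → toℕ i ≡ toℕ a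
  toℕ-splitˡ b {n} e = trans (cong toℕ (sym (FP.splitAt⁻¹-↑ˡ e))) (FP.toℕ-↑ˡ _ n)

  toℕ-splitʳ : ∀ b {n} {i : Fin (b + n)} {a} → splitAt b i ≡ inj₂ a → toℕ i ≡ b + toℕ a
  toℕ-splitʳ b e = trans (cong toℕ (sym (FP.splitAt⁻¹-↑ʳ e))) (FP.toℕ-↑ʳ b _)

-- the members of l(χ) are listed part by part, each part piece by piece
decode-lex : ∀ {m} (bs : Vec ℕ m) (i j : Fin (Vec.sum bs)) → toℕ i < toℕ j → LexBefore bs i j
decode-lex (b ∷ bs) i j i<j with splitAt b i in ei | splitAt b j in ej
... | inj₁ a | inj₁ a' = inj₂ (refl , subst₂ _<_ (toℕ-splitˡ b ei) (toℕ-splitˡ b ej) i<j)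
... | inj₁ a | inj₂ j' = inj₁ (s≤s z≤n)
... | inj₂ i' | inj₁ a' =
  ⊥-elim (ℕP.<-asym i<j (subst₂ _<_ (sym (toℕ-splitˡ b ej)) (sym (toℕ-splitʳ b ei))
                                     (ℕP.<-≤-trans (FP.toℕ<n a') (ℕP.m≤m+n b _))))
... | inj₂ i' | inj₂ j'
  with decode-lex bs i' j' (ℕP.+-cancelˡ-< b _ _ (subst₂ _<_ (toℕ-splitʳ b ei) (toℕ-splitʳ b ej) i<j))
...   | inj₁ lt = inj₁ (s≤s lt)
...   | inj₂ (e , lt) = inj₂ (cong suc e , lt)

inv2k-unit : ∀ k → Fin k → Σ ℕ λ K → inv2k k ≡ + 1 / suc K × suc K ≡ k + k
inv2k-unit (suc k') _ = k' + suc k' , refl , refl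

-- Given a (v,η,c₁,λ)-m-sequence χ with λ ≤ 1/N, where
-- c₁·a ≤ b implies a ≤ M·b and N ≥ 4k²M², call a vertex x of S_I bad for T_i
-- if x misses more than a 1/(2k) fraction of T_i in the direction in which
-- S_I should be complete to T_i.  Few vertices are bad, so deleting them
-- yields a (v,η,1/(2M),1/(N'+1))-m-sequence χ' whenever 4(N'+1) ≤ N; every
-- copy of H in χ' is then well-embedded in χ, and strong pairs transfer.
module Cleaning {T : Tournament} {m : ℕ} {v : Vec Bool m} {η : Vec ℕ (ones v)} {c₁ λ' : ℚ}
  (χ : MSeq T v η c₁ λ')
  (d : ℕ) (scale : ∀ a b → c₁ ℚ.* ℕtoℚ a ℚ.≤ ℕtoℚ b → a ≤ suc d * b)
  (N₁ : ℕ) (λ≤ : λ' ℚ.≤ (+ 1 / suc N₁))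
  (N' : ℕ) (N≥4k²M² : 4 * (kOf v η * kOf v η * suc d * suc d) ≤ suc N₁)
  (N≥4N' : 4 * suc N' ≤ suc N₁)
  where

  open MSeq χ
  open Misses T
  open DensityByMisses T

  private
    n = size T
    bs = blocks v η
    k = kOf v η
    M = suc d
    N = suc N₁
    2k = k + k

  -- the member T_i = L i of l(χ) is the piece-th piece of the part-th set of χ
  part : Fin k → Fin m
  part i = proj₁ (decode bs i)

  piece : (i : Fin k) → Fin (lookup bs (part i))
  piece i = proj₂ (decode bs i)

  L : Fin k → Subset n
  L i = P (part i) (piece i)

  piece⊆part : ∀ J b x → x ∈ P J b → x ∈ S J
  piece⊆part J b x x∈ with lookup v J in vJ
  ... | true = proj₂ (one-partition-cover J vJ x) b x∈
  ... | false = subst (x ∈_) (zero-piece J vJ b) x∈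

  piece-in-part : ∀ J b x → lookup (P J b) x ≡ true → lookup (S J) x ≡ true
  piece-in-part J b x e = ∈⇒true (piece⊆part J b x (true⇒∈ e))

  private
    tr = tr-exists T
    t₀ = proj₁ tr
    isTr = proj₂ tr

    tr-positive : Fin n → 0 < t₀
    tr-positive x = ℕP.<-≤-trans (s≤s z≤n)
      (subst (_≤ t₀) (SubP.∣⁅x⁆∣≡1 x) (proj₂ isTr ⁅ x ⁆ (singleton-transitive T x)))

    positive : ∀ {a} → 0 < M * a → 0 < a
    positive {zero} h rewrite ℕP.*-zeroʳ M = h
    positive {suc a} h = s≤s z≤n

  -- every piece contains at least a 1/M fraction of its part: a transitive
  -- part has at most tr(T) vertices, any other part has at most |T|
  part≤M*piece : ∀ J b → ∣ S J ∣ ≤ M * ∣ P J b ∣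
  part≤M*piece J b with lookup v J in vJ
  ... | true = ℕP.≤-trans (proj₂ isTr (S J) (one-transitive J vJ)) (scale t₀ _ (one-size J vJ b t₀ isTr))
  ... | false rewrite zero-piece J vJ b = ℕP.m≤n*m ∣ S J ∣ M

  -- pieces are nonempty as soon as T is, since then tr(T) ≥ 1 and |T| ≥ 1
  piece-nonempty : Fin n → ∀ J b → 0 < ∣ P J b ∣
  piece-nonempty x J b with lookup v J in vJ
  ... | true = positive (ℕP.<-≤-trans (tr-positive x) (scale t₀ _ (one-size J vJ b t₀ isTr)))
  ... | false rewrite zero-piece J vJ b =
    positive (ℕP.<-≤-trans (ℕP.<-≤-trans (s≤s z≤n) (FP.toℕ<n x)) (scale n _ (zero-size J vJ)))

  parts-dense : ∀ I J → I F.< J → N * misses (S I) (S J) ≤ ∣ S I ∣ * ∣ S J ∣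
  parts-dense I J I<J = dense⇒misses (S I) (S J) N₁ λ' λ≤ (dense I J I<J)

  -- The misses of x ∈ S_I that matter for T_i: parts are complete forwards,
  -- so x should dominate T_i if its part comes later and be dominated by it
  -- if its part comes earlier; within the same part nothing is required.
  excess-by : ∀ {I J : Fin m} → Tri (I F.< J) (I ≡ J) (J F.< I) → Subset n → Fin n → ℕ
  excess-by (tri< _ _ _) Y x = missesTo Y x
  excess-by (tri≈ _ _ _) Y x = 0
  excess-by (tri> _ _ _) Y x = missesFrom Y x

  excess : Fin m → Fin n → Fin k → ℕ
  excess I x i = excess-by (FP.<-cmp I (part i)) (L i) x

  excess-before : ∀ I x i → I F.< part i → excess I x i ≡ missesTo (L i) x
  excess-before I x i lt with FP.<-cmp I (part i)
  ... | tri< _ _ _ = refl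
  ... | tri≈ ¬lt _ _ = ⊥-elim (¬lt lt)
  ... | tri> ¬lt _ _ = ⊥-elim (¬lt lt)

  excess-same : ∀ I x i → I ≡ part i → excess I x i ≡ 0
  excess-same I x i eq with FP.<-cmp I (part i)
  ... | tri< _ ¬eq _ = ⊥-elim (¬eq eq)
  ... | tri≈ _ _ _ = refl
  ... | tri> _ ¬eq _ = ⊥-elim (¬eq eq)

  excess-after : ∀ I x i → part i F.< I → excess I x i ≡ missesFrom (L i) x
  excess-after I x i gt with FP.<-cmp I (part i)
  ... | tri< _ _ ¬gt = ⊥-elim (¬gt gt)
  ... | tri≈ _ _ ¬gt = ⊥-elim (¬gt gt)
  ... | tri> _ _ _ = refl

  Bad : Fin m → Fin n → Fin k → Set
  Bad I x i = ∣ L i ∣ < 2k * excess I x i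

  bad? : ∀ I x i → Dec (Bad I x i)
  bad? I x i = ∣ L i ∣ ℕ.<? 2k * excess I x i

  isBad : Fin m → Fin n → Fin k → Bool
  isBad I x i = does (bad? I x i)

  good : Fin m → Fin n → Bool
  good I x = not (does (FP.any? (bad? I x)))

  isBad⇒Bad : ∀ I x i → isBad I x i ≡ true → Bad I x i
  isBad⇒Bad I x i = true⇒witness (bad? I x i)
    where
    true⇒witness : ∀ {P : Set} (d : Dec P) → does d ≡ true → P
    true⇒witness (yes p) _ = p

  good⇒small-excess : ∀ I x → good I x ≡ true → ∀ i → 2k * excess I x i ≤ ∣ L i ∣
  good⇒small-excess I x g i with FP.any? (bad? I x)
  ... | no none = ℕP.≮⇒≥ λ b → none (i , b)

  ¬good⇒bad : ∀ I x → good I x ≡ false → ∃ λ i → isBad I x i ≡ true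
  ¬good⇒bad I x g with FP.any? (bad? I x)
  ... | yes (i , b) = i , dec-true (bad? I x i) b

  badCount : Fin m → Fin k → ℕ
  badCount I i = ∑[ x < n ] ⟦ lookup (S I) x ∧ isBad I x i ⟧

  -- Markov's inequality for one T_i: if each bad x has |T_i| < 2k·r x, and
  -- the r-values over S_I add up to at most |S_I||S_J|/N with J = part i,
  -- then at most 2kM|S_I|/N vertices of S_I are bad for T_i (|S_J| ≤ M|T_i|).
  few-bad-from : ∀ I i (r : Fin n → ℕ) → (∀ x → r x ≤ ∣ L i ∣) →
    (∀ x → isBad I x i ≡ true → ∣ L i ∣ < 2k * r x) →
    ∀ total → ∑[ x < n ] (⟦ lookup (S I) x ⟧ * r x) ≤ total →
    N * total ≤ ∣ S I ∣ * ∣ S (part i) ∣ → N * badCount I i ≤ 2k * M * ∣ S I ∣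
  few-bad-from I i r r≤ bad⇒ total ∑r≤ N*total≤ with ∣ L i ∣ ℕ.≟ 0
  ... | yes empty = ℕP.≤-trans (ℕP.≤-reflexive (trans (cong (N *_) none-bad) (ℕP.*-zeroʳ N))) z≤n
    where
    none-bad : badCount I i ≡ 0
    none-bad = sum-zero λ x → ⟦⟧-false λ q →
      let (_ , bad) = ∧-true q in
      ℕP.<-irrefl refl (ℕP.<-≤-trans (subst (_< 2k * r x) empty (bad⇒ x bad))
                                      (ℕP.≤-trans (ℕP.*-monoʳ-≤ 2k (subst (r x ≤_) empty (r≤ x)))
                                                  (ℕP.≤-reflexive (ℕP.*-zeroʳ 2k))))
  ... | no nonempty = ℕP.*-cancelʳ-≤ (N * badCount I i) (2k * M * ∣ S I ∣) ℓ {{ℕ.≢-nonZero nonempty}} (begin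
    N * badCount I i * ℓ             ≡⟨ ℕP.*-assoc N (badCount I i) ℓ ⟩
    N * (badCount I i * ℓ)           ≤⟨ ℕP.*-monoʳ-≤ N markov-bound ⟩
    N * (2k * total)                 ≡⟨ solve 3 (λ N a t → N :* (a :* t) := a :* (N :* t)) refl N 2k total ⟩
    2k * (N * total)                 ≤⟨ ℕP.*-monoʳ-≤ 2k N*total≤ ⟩
    2k * (∣ S I ∣ * ∣ S (part i) ∣)   ≤⟨ ℕP.*-monoʳ-≤ 2k (ℕP.*-monoʳ-≤ ∣ S I ∣ (part≤M*piece (part i) (piece i))) ⟩
    2k * (∣ S I ∣ * (M * ℓ))          ≡⟨ solve 4 (λ a s M l → a :* (s :* (M :* l)) := a :* M :* s :* l) refl 2k ∣ S I ∣ M ℓ ⟩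
    2k * M * ∣ S I ∣ * ℓ              ∎)
    where
    open ℕP.≤-Reasoning
    open +-*-Solver using (solve; _:*_; _:=_)
    ℓ = ∣ L i ∣
    markov-bound : badCount I i * ℓ ≤ 2k * total
    markov-bound = ℕP.≤-trans (markov (S I) (λ x → isBad I x i) r ℓ 2k (λ x _ bad → bad⇒ x bad))
                              (ℕP.*-monoʳ-≤ 2k ∑r≤)

  -- Each T_i makes at most 2kM|S_I|/N vertices of S_I bad: the relevant
  -- misses all lie between S_I and S_{part i}, which is dense in χ.
  few-bad : ∀ I i → N * badCount I i ≤ 2k * M * ∣ S I ∣
  few-bad I i = by-order (FP.<-cmp I (part i))
    where
    by-order : Tri (I F.< part i) (I ≡ part i) (part i F.< I) → N * badCount I i ≤ 2k * M * ∣ S I ∣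
    by-order (tri< I<J _ _) =
      few-bad-from I i (missesTo (L i)) (missesTo≤ (L i))
        (λ x bad → subst (λ e → ∣ L i ∣ < 2k * e) (excess-before I x i I<J) (isBad⇒Bad I x i bad))
        (misses (S I) (S (part i)))
        (misses-mono {S I} {S I} {S (part i)} {L i} (λ _ e → e) (piece-in-part (part i) (piece i)))
        (parts-dense I (part i) I<J)
    by-order (tri≈ _ I≡J _) = ℕP.≤-trans (ℕP.≤-reflexive (trans (cong (N *_) none-bad) (ℕP.*-zeroʳ N))) z≤n
      where
      none-bad : badCount I i ≡ 0
      none-bad = sum-zero λ x → ⟦⟧-false λ q →
        ℕP.<⇒≱ (isBad⇒Bad I x i (proj₂ (∧-true q)))
                (ℕP.≤-trans (ℕP.≤-reflexive (trans (cong (2k *_) (excess-same I x i I≡J)) (ℕP.*-zeroʳ 2k))) z≤n)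
    by-order (tri> _ _ J<I) =
      few-bad-from I i (missesFrom (L i)) (missesFrom≤ (L i))
        (λ x bad → subst (λ e → ∣ L i ∣ < 2k * e) (excess-after I x i J<I) (isBad⇒Bad I x i bad))
        (misses (S (part i)) (S I))
        (ℕP.≤-trans (ℕP.≤-reflexive (sym (misses-by-column (L i) (S I))))
                    (misses-mono {S (part i)} {L i} {S I} {S I} (piece-in-part (part i) (piece i)) (λ _ e → e)))
        (subst (N * misses (S (part i)) (S I) ≤_) (ℕP.*-comm ∣ S (part i) ∣ ∣ S I ∣) (parts-dense (part i) I J<I))

  totalBad : Fin m → ℕ
  totalBad I = ∑[ i < k ] badCount I i

  -- Summing over the k sets T_i, and using N ≥ 4k²M²: at most a 1/(2M)
  -- fraction of S_I is bad for some T_i.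
  total-bad-small : ∀ I → (M + M) * totalBad I ≤ ∣ S I ∣
  total-bad-small I = ℕP.*-cancelˡ-≤ N (begin
    N * ((M + M) * totalBad I)            ≡⟨ solve 3 (λ N a b → N :* (a :* b) := a :* (N :* b)) refl N (M + M) (totalBad I) ⟩
    (M + M) * (N * totalBad I)            ≤⟨ ℕP.*-monoʳ-≤ (M + M) sum-bound ⟩
    (M + M) * (k * (2k * M * ∣ S I ∣))     ≡⟨ solve 3 (λ M k s → (M :+ M) :* (k :* ((k :+ k) :* M :* s)) := con 4 :* (k :* k :* M :* M) :* s) refl M k ∣ S I ∣ ⟩
    4 * (k * k * M * M) * ∣ S I ∣          ≤⟨ ℕP.*-monoˡ-≤ ∣ S I ∣ N≥4k²M² ⟩
    N * ∣ S I ∣                           ∎)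
    where
    open ℕP.≤-Reasoning
    open +-*-Solver using (solve; _:*_; _:+_; _:=_; con)
    sum-bound : N * totalBad I ≤ k * (2k * M * ∣ S I ∣)
    sum-bound = begin
      N * totalBad I                     ≡⟨ *-distribˡ-sum N (badCount I) ⟩
      ∑[ i < k ] (N * badCount I i)      ≤⟨ sum-mono (few-bad I) ⟩
      ∑[ i < k ] (2k * M * ∣ S I ∣)       ≡⟨ sum-const k _ ⟩
      k * (2k * M * ∣ S I ∣)              ∎

  keep-good : Fin m → Subset n → Subset n
  keep-good I A = tabulate λ x → lookup A x ∧ good I x

  -- a vertex of S_I that is not good is bad for some T_i, so a subset A of
  -- S_I loses at most totalBad I vertices
  keep-good-loses-little : ∀ I A → (∀ x → lookup A x ≡ true → lookup (S I) x ≡ true) →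
                           ∣ A ∣ ≤ ∣ keep-good I A ∣ + totalBad I
  keep-good-loses-little I A A⊆SI = begin
    ∣ A ∣                                                      ≡⟨ ∣∣≡∑ A ⟩
    ∑[ x < n ] ⟦ lookup A x ⟧                                  ≤⟨ sum-mono (λ x → lost-or-kept (lookup A x) (good I x) (witness x)) ⟩
    ∑[ x < n ] (⟦ lookup A x ∧ good I x ⟧ + badness x)          ≡⟨ ∑-distrib-+ (λ x → ⟦ lookup A x ∧ good I x ⟧) badness ⟩
    ∑[ x < n ] ⟦ lookup A x ∧ good I x ⟧ + ∑[ x < n ] badness x ≡⟨ cong₂ _+_ (sym kept) (∑-comm (λ x i → ⟦ lookup (S I) x ∧ isBad I x i ⟧)) ⟩
    ∣ keep-good I A ∣ + totalBad I                               ∎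
    where
    open ℕP.≤-Reasoning
    badness : Fin n → ℕ
    badness x = ∑[ i < k ] ⟦ lookup (S I) x ∧ isBad I x i ⟧
    witness : ∀ x → lookup A x ≡ true → good I x ≡ false → 1 ≤ badness x
    witness x x∈A ¬good with ¬good⇒bad I x ¬good
    ... | i , bad = ℕP.≤-trans (ℕP.≤-reflexive (cong ⟦_⟧ (sym (cong₂ _∧_ (A⊆SI x x∈A) bad))))
                               (term≤sum (λ i → ⟦ lookup (S I) x ∧ isBad I x i ⟧) i)
    lost-or-kept : ∀ a g {s} → (a ≡ true → g ≡ false → 1 ≤ s) → ⟦ a ⟧ ≤ ⟦ a ∧ g ⟧ + s
    lost-or-kept false g h = z≤n
    lost-or-kept true true h = s≤s z≤n
    lost-or-kept true false h = h refl refl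
    kept : ∣ keep-good I A ∣ ≡ ∑[ x < n ] ⟦ lookup A x ∧ good I x ⟧
    kept = trans (∣∣≡∑ (keep-good I A)) (sum-cong-≗ (λ x → cong ⟦_⟧ (VP.lookup∘tabulate (λ x → lookup A x ∧ good I x) x)))

  S' : Fin m → Subset n
  S' I = keep-good I (S I)

  P' : (I : Fin m) → Fin (lookup bs I) → Subset n
  P' I a = keep-good I (P I a)

  ∈keep-good : ∀ I {A x} → x ∈ keep-good I A → x ∈ A × good I x ≡ true
  ∈keep-good I {A} {x} x∈ =
    let (x∈A , g) = ∧-true (trans (sym (VP.lookup∘tabulate (λ x → lookup A x ∧ good I x) x)) (∈⇒true x∈))
    in true⇒∈ x∈A , g

  keep-good-∈ : ∀ I {A x} → x ∈ A → good I x ≡ true → x ∈ keep-good I A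
  keep-good-∈ I {A} {x} x∈A g =
    true⇒∈ (trans (VP.lookup∘tabulate (λ x → lookup A x ∧ good I x) x) (cong₂ _∧_ (∈⇒true x∈A) g))

  S'⊆S : ∀ I x → x ∈ S' I → x ∈ S I
  S'⊆S I x x∈ = proj₁ (∈keep-good I x∈)

  P'⊆P : ∀ I a x → x ∈ P' I a → x ∈ P I a
  P'⊆P I a x x∈ = proj₁ (∈keep-good I x∈)

  S'-large : ∀ I → ∣ S I ∣ ≤ ∣ S' I ∣ + ∣ S' I ∣
  S'-large I = ℕP.≤-trans lost (ℕP.+-monoʳ-≤ ∣ S' I ∣ bad≤kept)
    where
    open ℕP.≤-Reasoning
    lost : ∣ S I ∣ ≤ ∣ S' I ∣ + totalBad I
    lost = keep-good-loses-little I (S I) (λ _ e → e)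
    2≤M+M : 2 ≤ M + M
    2≤M+M = ℕP.+-mono-≤ (s≤s z≤n) (s≤s z≤n)
    2bad≤ : totalBad I + totalBad I ≤ ∣ S I ∣
    2bad≤ = begin
      totalBad I + totalBad I         ≡⟨ cong (_+_ (totalBad I)) (ℕP.+-identityʳ (totalBad I)) ⟨
      2 * totalBad I                  ≤⟨ ℕP.*-monoˡ-≤ (totalBad I) 2≤M+M ⟩
      (M + M) * totalBad I            ≤⟨ total-bad-small I ⟩
      ∣ S I ∣                          ∎
    bad≤kept : totalBad I ≤ ∣ S' I ∣
    bad≤kept = ℕP.+-cancelˡ-≤ ∣ S I ∣ _ _ (begin
      ∣ S I ∣ + totalBad I                   ≤⟨ ℕP.+-monoˡ-≤ (totalBad I) lost ⟩
      ∣ S' I ∣ + totalBad I + totalBad I     ≡⟨ ℕP.+-assoc ∣ S' I ∣ (totalBad I) (totalBad I) ⟩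
      ∣ S' I ∣ + (totalBad I + totalBad I)   ≤⟨ ℕP.+-monoʳ-≤ ∣ S' I ∣ 2bad≤ ⟩
      ∣ S' I ∣ + ∣ S I ∣                      ≡⟨ ℕP.+-comm ∣ S' I ∣ ∣ S I ∣ ⟩
      ∣ S I ∣ + ∣ S' I ∣                      ∎)

  P'-large : ∀ I → lookup v I ≡ true → ∀ a t → IsTr T t → t ≤ (M + M) * ∣ P' I a ∣
  P'-large I vI a t isT = ℕP.+-cancelˡ-≤ t t ((M + M) * ∣ P' I a ∣) (begin
    t + t                                          ≤⟨ ℕP.+-mono-≤ t≤MP t≤MP ⟩
    M * ∣ P I a ∣ + M * ∣ P I a ∣                   ≡⟨ ℕP.*-distribʳ-+ ∣ P I a ∣ M M ⟨
    (M + M) * ∣ P I a ∣                             ≤⟨ ℕP.*-monoʳ-≤ (M + M) lost ⟩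
    (M + M) * (∣ P' I a ∣ + totalBad I)             ≡⟨ ℕP.*-distribˡ-+ (M + M) ∣ P' I a ∣ (totalBad I) ⟩
    (M + M) * ∣ P' I a ∣ + (M + M) * totalBad I     ≤⟨ ℕP.+-monoʳ-≤ ((M + M) * ∣ P' I a ∣) bad≤t ⟩
    (M + M) * ∣ P' I a ∣ + t                        ≡⟨ ℕP.+-comm _ t ⟩
    t + (M + M) * ∣ P' I a ∣                        ∎)
    where
    open ℕP.≤-Reasoning
    t≤MP : t ≤ M * ∣ P I a ∣
    t≤MP = scale t _ (one-size I vI a t isT)
    lost : ∣ P I a ∣ ≤ ∣ P' I a ∣ + totalBad I
    lost = keep-good-loses-little I (P I a) (piece-in-part I a)
    bad≤t : (M + M) * totalBad I ≤ t
    bad≤t = ℕP.≤-trans (total-bad-small I) (proj₂ isT (S I) (one-transitive I vI))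

  -- the cleaned parts are still pairwise dense: they keep half of each part,
  -- so their misses make up at most a 4/N ≤ 1/(N'+1) fraction of their pairs
  cleaned-dense : ∀ I J → I F.< J → DensityAtLeast T (S' I) (S' J) (1ℚ ℚ.- (+ 1 / suc N'))
  cleaned-dense I J I<J = misses⇒dense (S' I) (S' J) N' nonempty few-misses
    where
    open ℕP.≤-Reasoning
    open +-*-Solver using (solve; _:*_; _:+_; _:=_; con)
    halves-nonempty : ∀ {a b} → 0 < a → a ≤ b + b → 0 < b
    halves-nonempty {b = suc b} _ _ = s≤s z≤n
    halves-nonempty {b = zero} 0<a a≤0 = ⊥-elim (ℕP.<-irrefl refl (ℕP.<-≤-trans 0<a a≤0))
    pairs-nonempty : NonZero (∣ S I ∣ * ∣ S J ∣)
    pairs-nonempty = proj₁ (dense I J I<J)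
    nonempty : 0 < ∣ S' I ∣ * ∣ S' J ∣
    nonempty = ℕP.*-mono-< {0} {∣ S' I ∣} {0} {∣ S' J ∣}
      (halves-nonempty (ℕ.>-nonZero⁻¹ ∣ S I ∣ {{ℕP.m*n≢0⇒m≢0 ∣ S I ∣ {{pairs-nonempty}}}}) (S'-large I))
      (halves-nonempty (ℕ.>-nonZero⁻¹ ∣ S J ∣ {{ℕP.m*n≢0⇒n≢0 ∣ S I ∣ {{pairs-nonempty}}}}) (S'-large J))
    few-misses : suc N' * misses (S' I) (S' J) ≤ ∣ S' I ∣ * ∣ S' J ∣
    few-misses = ℕP.*-cancelˡ-≤ 4 (begin
      4 * (suc N' * misses (S' I) (S' J))     ≡⟨ ℕP.*-assoc 4 (suc N') _ ⟨
      4 * suc N' * misses (S' I) (S' J)       ≤⟨ ℕP.*-mono-≤ N≥4N' (misses-mono {S I} {S' I} {S J} {S' J} (in-part I) (in-part J)) ⟩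
      N * misses (S I) (S J)                  ≤⟨ parts-dense I J I<J ⟩
      ∣ S I ∣ * ∣ S J ∣                         ≤⟨ ℕP.*-mono-≤ (S'-large I) (S'-large J) ⟩
      (∣ S' I ∣ + ∣ S' I ∣) * (∣ S' J ∣ + ∣ S' J ∣) ≡⟨ solve 2 (λ a b → (a :+ a) :* (b :+ b) := con 4 :* (a :* b)) refl ∣ S' I ∣ ∣ S' J ∣ ⟩
      4 * (∣ S' I ∣ * ∣ S' J ∣)                 ∎)
      where
      in-part : ∀ K x → lookup (S' K) x ≡ true → lookup (S K) x ≡ true
      in-part K x e = ∈⇒true (S'⊆S K x (true⇒∈ e))

  cleaned : MSeq T v η (+ 1 / (M + M)) (+ 1 / suc N')
  cleaned = record
    { S = S'
    ; P = P'
    ; disjoint = λ I J I≢J x x∈I x∈J → disjoint I J I≢J x (S'⊆S I x x∈I) (S'⊆S J x x∈J)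
    ; one-transitive = λ I vI → transitive-⊆ T (S'⊆S I) (one-transitive I vI)
    ; one-partition-disj = λ I vI a b a≢b x x∈a x∈b →
        one-partition-disj I vI a b a≢b x (P'⊆P I a x x∈a) (P'⊆P I b x x∈b)
    ; one-partition-cover = λ I vI x → cover I vI x
    ; one-complete = λ I vI a b a<b x y x∈ y∈ → one-complete I vI a b a<b x y (P'⊆P I a x x∈) (P'⊆P I b y y∈)
    ; one-size = λ I vI a t isT → unit-fraction-≤ (d + M) t ∣ P' I a ∣ (P'-large I vI a t isT)
    ; zero-piece = λ I vI a → cong (keep-good I) (zero-piece I vI a)
    ; zero-size = λ I vI → unit-fraction-≤ (d + M) n ∣ S' I ∣ (zero-large I vI)
    ; dense = cleaned-dense
    }
    where
    cover : ∀ I → lookup v I ≡ true → ∀ x →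
            (x ∈ S' I → ∃ λ a → x ∈ P' I a) × (∀ a → x ∈ P' I a → x ∈ S' I)
    cover I vI x = (λ x∈S' → let (x∈S , g) = ∈keep-good I x∈S'
                                 (a , x∈P) = proj₁ (one-partition-cover I vI x) x∈S
                             in a , keep-good-∈ I x∈P g)
                 , (λ a x∈P' → let (x∈P , g) = ∈keep-good I x∈P'
                               in keep-good-∈ I (proj₂ (one-partition-cover I vI x) a x∈P) g)
    zero-large : ∀ I → lookup v I ≡ false → n ≤ (M + M) * ∣ S' I ∣
    zero-large I vI = begin
      n                             ≤⟨ scale n _ (zero-size I vI) ⟩
      M * ∣ S I ∣                    ≤⟨ ℕP.*-monoʳ-≤ M (S'-large I) ⟩
      M * (∣ S' I ∣ + ∣ S' I ∣)       ≡⟨ ℕP.*-distribˡ-+ M ∣ S' I ∣ ∣ S' I ∣ ⟩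
      M * ∣ S' I ∣ + M * ∣ S' I ∣     ≡⟨ ℕP.*-distribʳ-+ ∣ S' I ∣ M M ⟨
      (M + M) * ∣ S' I ∣             ∎
      where open ℕP.≤-Reasoning

  single-piece : ∀ I → lookup v I ≡ false → (a b : Fin (lookup bs I)) → toℕ a < toℕ b → ⊥
  single-piece I vI a b a<b with ℕP.<-≤-trans (FP.toℕ<n b) (ℕP.≤-reflexive one-block)
    where
    one-block : lookup bs I ≡ 1
    one-block = trans (VP.lookup∘tabulate _ I) (cong (λ z → if z then ηAt v η I else 1) vI)
  ... | s≤s b≤0 = ℕP.<-irrefl refl (ℕP.<-≤-trans a<b (ℕP.≤-trans b≤0 z≤n))

  earlier-piece-complete : ∀ I a J b x → x ∈ P I a → I ≡ J → toℕ a < toℕ b → missesTo (P J b) x ≡ 0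
  earlier-piece-complete I a .I b x x∈ refl a<b with lookup v I in vI
  ... | true = missesTo-complete (P I b) x (λ y y∈ → one-complete I vI a b a<b x y x∈ (true⇒∈ y∈))
  ... | false = ⊥-elim (single-piece I vI a b a<b)

  later-piece-complete : ∀ J b I a x → x ∈ P I a → J ≡ I → toℕ b < toℕ a → missesFrom (P J b) x ≡ 0
  later-piece-complete .I b I a x x∈ refl b<a with lookup v I in vI
  ... | true = missesFrom-complete (P I b) x (λ y y∈ → one-complete I vI b a b<a y x (true⇒∈ y∈) x∈)
  ... | false = ⊥-elim (single-piece I vI b a b<a)

  -- A vertex x of the cleaned T'_j misses at most |T_i|/(2k) of every T_i
  -- after it (resp. before it) in l(χ): across parts because x is good,
  -- within a part because pieces are complete to later ones.
  cleaned-piece : Fin k → Subset n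
  cleaned-piece j = P' (part j) (piece j)

  private
    no-misses : ∀ {e ℓ} → e ≡ 0 → 2k * e ≤ ℓ
    no-misses {ℓ = ℓ} refl = subst (_≤ ℓ) (sym (ℕP.*-zeroʳ 2k)) z≤n

  sparse-forwards : ∀ j i x → x ∈ cleaned-piece j → LexBefore bs j i → 2k * missesTo (L i) x ≤ ∣ L i ∣
  sparse-forwards j i x x∈ (inj₁ earlier-part) =
    subst (λ e → 2k * e ≤ ∣ L i ∣) (excess-before (part j) x i earlier-part)
          (good⇒small-excess (part j) x (proj₂ (∈keep-good (part j) {P (part j) (piece j)} x∈)) i)
  sparse-forwards j i x x∈ (inj₂ (same-part , earlier-piece)) =
    no-misses (earlier-piece-complete (part j) (piece j) (part i) (piece i) x
                                      (P'⊆P (part j) (piece j) x x∈) same-part earlier-piece)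

  sparse-backwards : ∀ j i x → x ∈ cleaned-piece j → LexBefore bs i j → 2k * missesFrom (L i) x ≤ ∣ L i ∣
  sparse-backwards j i x x∈ (inj₁ earlier-part) =
    subst (λ e → 2k * e ≤ ∣ L i ∣) (excess-after (part j) x i earlier-part)
          (good⇒small-excess (part j) x (proj₂ (∈keep-good (part j) {P (part j) (piece j)} x∈)) i)
  sparse-backwards j i x x∈ (inj₂ (same-part , earlier-piece)) =
    no-misses (later-piece-complete (part i) (piece i) (part j) (piece j) x
                                    (P'⊆P (part j) (piece j) x x∈) same-part earlier-piece)

  well-embedded : ∀ (H : Tournament) (f : Fin (size H) → Fin k) x →
                  Embedding cleaned H f x → WellEmbedded χ H f (inv2k k)
  well-embedded H f x (x∈ , injective , isomorphic) =
    x , ((λ j → P'⊆P _ _ (x j) (x∈ j)) , injective , isomorphic) , dense-around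
    where
    dense-around : ∀ i → (∀ j → ¬ (x j ∈ long χ i)) → ∀ j →
      (f j F.< i → DensityAtLeast T ⁅ x j ⁆ (long χ i) (1ℚ ℚ.- inv2k k)) ×
      (i F.< f j → DensityAtLeast T (long χ i) ⁅ x j ⁆ (1ℚ ℚ.- inv2k k))
    dense-around i _ j with inv2k-unit k i
    ... | K , μ≡ , K+1≡2k rewrite μ≡ =
      (λ j<i → missesTo⇒dense (x j) (L i) K (piece-nonempty (x j) (part i) (piece i))
                 (subst (λ z → z * missesTo (L i) (x j) ≤ ∣ L i ∣) (sym K+1≡2k)
                        (sparse-forwards (f j) i (x j) (x∈ j) (decode-lex bs (f j) i j<i)))) ,
      (λ i<j → missesFrom⇒dense (x j) (L i) K (piece-nonempty (x j) (part i) (piece i))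
                 (subst (λ z → z * missesFrom (L i) (x j) ≤ ∣ L i ∣) (sym K+1≡2k)
                        (sparse-backwards (f j) i (x j) (x∈ j) (decode-lex bs i (f j) i<j))))

  strong-pair : ∀ c → HasStrongPair cleaned c → HasStrongPair χ c
  strong-pair c (A , B , A⊆ , B⊆ , rest) = A , B , inside A⊆ , inside B⊆ , rest
    where
    inside : ∀ {X} → (∀ x → x ∈ X → _∈Vχ cleaned x) → ∀ x → x ∈ X → _∈Vχ χ x
    inside X⊆ x x∈ = let (I , x∈S') = X⊆ x x∈ in I , S'⊆S I x x∈S'

theorem8 : ∀ (t m : ℕ) (Hs : Fin t → Tournament) (v : Vec Bool m) (η : Vec ℕ (ones v))
           → (∀ i → 0 < lookup η i)
           → (Fs : (i : Fin t) → Fin (size (Hs i)) → Fin (kOf v η))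
           → (∀ i a b → Fs i a ≡ Fs i b → a ≡ b)
           → StrongEH Hs v η Fs → SuperStrongEH Hs v η Fs
theorem8 t m Hs v η _ Fs _ strong c₁ 0<c₁ = + 1 / suc N₁ , c₂ , unit-fraction-pos N₁ , 0<c₂ , super
  where
  -- c₁·a ≤ b forces a ≤ M·b with M = d + 1 the denominator of c₁
  d = ℚ.denominator-1 c₁
  M = suc d
  k = kOf v η
  -- the strong EH-property for c = 1/(2M) supplies λ₀' ≥ 1/(N''+2) and c₂
  strong-at-1/2M = strong (+ 1 / (M + M)) (unit-fraction-pos (d + M))
  c₂ = proj₁ (proj₂ strong-at-1/2M)
  0<c₂ = proj₁ (proj₂ (proj₂ (proj₂ strong-at-1/2M)))
  strong-dichotomy = proj₂ (proj₂ (proj₂ (proj₂ strong-at-1/2M)))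
  below-λ₀' = unit-fraction-below (proj₁ strong-at-1/2M) (proj₁ (proj₂ (proj₂ strong-at-1/2M)))
  N' = suc (proj₁ below-λ₀')
  -- λ₀ = 1/(N₁+1) with N₁ + 1 ≥ 4k²M² and ≥ 4(N'+1)
  Q = k * k * M * M
  N₁ = 4 * (suc N' * suc Q)
  large₁ : 4 * Q ≤ suc N₁
  large₁ = ℕP.≤-trans (ℕP.*-monoʳ-≤ 4 (ℕP.≤-trans (ℕP.n≤1+n Q) (ℕP.m≤n*m (suc Q) (suc N')))) (ℕP.n≤1+n N₁)
  large₂ : 4 * suc N' ≤ suc N₁
  large₂ = ℕP.≤-trans (ℕP.*-monoʳ-≤ 4 (ℕP.m≤m*n (suc N') (suc Q))) (ℕP.n≤1+n N₁)
  super : ∀ (T : Tournament) (λ' : ℚ) → 0ℚ ℚ.≤ λ' → λ' ℚ.≤ (+ 1 / suc N₁) → λ' ℚ.< 1ℚ →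
          (χ : MSeq T v η c₁ λ') →
          (Σ _ λ i → WellEmbedded χ (Hs i) (Fs i) (inv2k k)) ⊎ HasStrongPair χ c₂
  super T λ' _ λ≤ _ χ =
    Sum.map (λ (i , x , copy) → i , well-embedded (Hs i) (Fs i) x copy) (strong-pair c₂)
            (strong-dichotomy T (+ 1 / suc N') (ℚP.<⇒≤ (unit-fraction-pos N')) (proj₂ below-λ₀')
                              (unit-fraction-<1 (proj₁ below-λ₀')) cleaned)
    where open Cleaning χ d (≤-denominator c₁ 0<c₁) N₁ λ≤ N' large₁ large₂
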